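{- Let $D_n=\langle x,a\mid x^n=a^2=e,\ ax=x^{ -1}a\rangle$ and $C_n=\langle x\rangle$. Let $X\subseteq C_n\setminus\{e\}$ and $Y\subseteq C_n$, and let $\mu,\lambda,t$ be integers. Then the Cayley graph $\mathcal{C}(D_n,X\cup Ya)$ is a directed strongly regular graph with parameters $(2n,|X|+|Y|,\mu,\lambda,t)$ if and only if, in the group ring $\mathbb{Z}[C_n]$, $$(\overline{X}+\overline{X^{(-1)}})\overline{Y}=(\lambda-\mu)\overline{Y}+\mu\overline{C_n}\quad\text{and}\quad \overline{X}^2+\overline{Y}\,\overline{Y^{(-1)}}=(t-\mu)e+(\lambda-\mu)\overline{X}+\mu\overline{C_n}.$$
   Context: $Ya=\{ya:y\in Y\}$, $X^{(-1)}=\{g^{ -1}:g\in X\}$, and for a subset $U$ of $C_n$, $\overline{U}=\sum_{u\in U}u\in\mathbb{Z}[C_n]$. For $S\subseteq G\setminus\{e\}$, the Cayley graph $\mathcal{C}(G,S)$ has vertex set $G$ and an arc $u\to w$ iff $wu^{ -1}\in S$. A directed graph on $N$ vertices with $0/1$ adjacency matrix $A$ (zero diagonal) is a directed strongly regular graph with parameters $(N,k,\mu,\lambda,t)$ if $JA=AJ=kJ$ and $A^2=tI+\lambda A+\mu(J-I-A)$, $J$ the all-ones matrix. -}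

module Defs where

open import Data.Nat as ℕ using (ℕ; zero; suc; NonZero)
open import Data.Nat.DivMod using (_mod_)
open import Data.Integer as ℤ using (ℤ; +_; _+_; _-_; _*_)
open import Data.Fin as Fin using (Fin; toℕ; remQuot)
open import Data.Fin.Subset using (Subset; _∈_; _∉_; ∣_∣)
open import Data.Fin.Subset.Properties using (_∈?_)
open import Data.Bool using (Bool; true; false; if_then_else_; _xor_)
open import Data.Product using (_×_; _,_)
open import Data.Sum using (_⊎_)
open import Relation.Binary.PropositionalEquality using (_≡_)
open import Relation.Nullary.Decidable using (does)

Σ : (N : ℕ) → (Fin N → ℤ) → ℤ
Σ zero    f = + 0
Σ (suc N) f = f Fin.zero + Σ N (λ i → f (Fin.suc i))

boolℤ : Bool → ℤ
boolℤ true  = + 1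
boolℤ false = + 0

δ : {N : ℕ} → Fin N → Fin N → ℤ
δ i j = boolℤ (does (i Fin.≟ j))

-- Directed strongly regular graph with parameters (N,k,μ,λ,t),
-- given by its adjacency matrix A (indexed by Fin N).
-- (J A)_{ij} = Σ_l A_{lj},  (A J)_{ij} = Σ_l A_{il}.

record IsDSRG (N : ℕ) (k μ lam t : ℤ) (A : Fin N → Fin N → ℤ) : Set where
  field
    zero-one : ∀ i j → A i j ≡ + 0 ⊎ A i j ≡ + 1
    zero-diag : ∀ i → A i i ≡ + 0
    JA≡kJ : ∀ (i j : Fin N) → Σ N (λ l → A l j) ≡ k
    AJ≡kJ : ∀ (i j : Fin N) → Σ N (λ l → A i l) ≡ k
    A²-eq : ∀ i j →
      Σ N (λ l → A i l * A l j)
        ≡ t * δ i j + lam * A i j + μ * (+ 1 - δ i j - A i j)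

-- Cyclic group C_n = ⟨x⟩, x^i represented by i : Fin n (exponent mod n)

module Cyclic (n : ℕ) .{{_ : NonZero n}} where

  C : Set
  C = Fin n

  e : C
  e = 0 mod n

  _⊕_ : C → C → C
  i ⊕ j = (toℕ i ℕ.+ toℕ j) mod n

  ⊖_ : C → C
  ⊖ i = (n ℕ.∸ toℕ i) mod n

  -- Dihedral group D_n: (i , s) stands for x^i a^s (s = true means a).
  D : Set
  D = C × Bool

  _·_ : D → D → D
  (i , s) · (j , r) = (i ⊕ (if s then ⊖ j else j)) , (s xor r)

  inv : D → D
  inv (i , false) = (⊖ i) , false
  inv (i , true)  = i , true

  inS : Subset n → Subset n → D → Bool
  inS X Y (i , false) = does (i ∈? X)
  inS X Y (i , true)  = does (i ∈? Y)

  -- Enumeration of D_n by Fin (2 * n): the first component of remQuot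
  -- (in Fin 2) is the exponent of a, the second the exponent of x.
  dec : Fin (2 ℕ.* n) → D
  dec v with remQuot {2} n v
  ... | (Fin.zero , i) = i , false
  ... | (Fin.suc _ , i) = i , true

  -- adjacency matrix of the Cayley graph C(D_n, X ∪ Ya):
  -- arc u → w iff w u⁻¹ ∈ S
  cayleyAdj : Subset n → Subset n → Fin (2 ℕ.* n) → Fin (2 ℕ.* n) → ℤ
  cayleyAdj X Y u w = boolℤ (inS X Y (dec w · inv (dec u)))

  -- Group ring ℤ[C_n]: elements are coefficient functions C → ℤ

  ZC : Set
  ZC = C → ℤ

  _+ᴳ_ : ZC → ZC → ZC
  (f +ᴳ g) i = f i + g i

  _*ᴳ_ : ZC → ZC → ZC
  (f *ᴳ g) k = Σ n (λ i → f i * g (k ⊕ (⊖ i)))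

  _·ᴳ_ : ℤ → ZC → ZC
  (c ·ᴳ f) i = c * f i

  _≈ᴳ_ : ZC → ZC → Set
  f ≈ᴳ g = ∀ i → f i ≡ g i

  eᴳ : ZC
  eᴳ i = δ e i

  bar : Subset n → ZC
  bar U i = boolℤ (does (i ∈? U))

  barInv : Subset n → ZC
  barInv U i = boolℤ (does ((⊖ i) ∈? U))

  barC : ZC
  barC _ = + 1

-- The arc u → w is present iff w u⁻¹ ∈ S, so the entries of A and of A² depend only on the
-- quotient z = w u⁻¹: A_{uw} = χ(z) and (A²)_{uw} = (χ ⋆ χ)(z), where χ is the indicator of S and ⋆
-- is convolution over D_n. The strongly-regular identity thus says χ ⋆ χ = t·δₑ + λ·χ + μ·(1 − δₑ − χ)
-- pointwise on D_n. Evaluated at the rotations x^k this is the second equation in ℤ[C_n], and at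
-- the reflections x^k a the first; row and column sums are |S| because translations permute D_n.
module Submission where

open import Algebra.Bundles using (AbelianGroup; Group)
open import Algebra.Structures using (IsAbelianGroup; IsGroup)
open import Data.Bool using (Bool; true; false; if_then_else_; _xor_)
open import Data.Bool.Properties using (xor-assoc; xor-identityʳ)
open import Data.Fin as Fin using (Fin; toℕ; _↑ˡ_; _↑ʳ_; combine; remQuot)
open import Data.Fin.Patterns using (0F; 1F)
open import Data.Fin.Permutation using (Permutation′; permutation; _⟨$⟩ʳ_)
open import Data.Fin.Properties using (toℕ-injective; toℕ-fromℕ<; toℕ<n; remQuot-combine; combine-remQuot)
open import Data.Fin.Subset using (Subset; _∉_; ∣_∣)
open import Data.Fin.Subset.Properties using (_∈?_)
open import Data.Integer using (ℤ; +_; _+_; _-_; _*_)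
open import Data.Integer.Properties as ℤₚ using (+-0-commutativeMonoid; +-assoc; +-identityˡ; +-identityʳ; *-comm; *-distribʳ-+)
open import Data.Integer.Tactic.RingSolver using (solve-∀)
open import Data.Nat as ℕ using (ℕ; zero; suc; NonZero; _%_)
open import Data.Nat.DivMod using (_mod_; %-distribˡ-+; m<n⇒m%n≡m; [m+n]%n≡m%n)
open import Data.Nat.Properties as ℕₚ using (m+[n∸m]≡n; <⇒≤)
open import Data.Product using (_×_; _,_; uncurry)
open import Data.Sum using (_⊎_; inj₁; inj₂)
open import Data.Vec using ([]; _∷_)
open import Function using (_∘_; _⇔_; mk⇔; Equivalence)
open import Relation.Binary.PropositionalEquality
open import Relation.Binary.PropositionalEquality.Algebra using (isMagma)
open import Relation.Nullary using (yes; no; ¬_)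
open import Relation.Nullary.Decidable using (does; dec-true; dec-false)
open import Level using (0ℓ)
open import Defs
import Function.Properties.Equivalence as ⇔
import Algebra.Properties.AbelianGroup as AbelianGroupProperties
import Algebra.Properties.Group as GroupProperties
import Algebra.Properties.CommutativeMonoid.Sum as CommutativeMonoidSum
open ≡-Reasoning

module ℤSum = CommutativeMonoidSum +-0-commutativeMonoid

Σ≡sum : ∀ m (f : Fin m → ℤ) → Σ m f ≡ ℤSum.sum f
Σ≡sum zero    f = refl
Σ≡sum (suc m) f = cong (_+_ (f 0F)) (Σ≡sum m (f ∘ Fin.suc))

Σ-cong : ∀ m {f g : Fin m → ℤ} → f ≗ g → Σ m f ≡ Σ m g
Σ-cong m {f} {g} f≗g = begin
  Σ m f        ≡⟨ Σ≡sum m f ⟩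
  ℤSum.sum f   ≡⟨ ℤSum.sum-cong-≗ f≗g ⟩
  ℤSum.sum g   ≡⟨ Σ≡sum m g ⟨
  Σ m g        ∎

Σ-distrib-+ : ∀ m (f g : Fin m → ℤ) → Σ m (λ i → f i + g i) ≡ Σ m f + Σ m g
Σ-distrib-+ m f g = begin
  Σ m (λ i → f i + g i)           ≡⟨ Σ≡sum m _ ⟩
  ℤSum.sum (λ i → f i + g i)      ≡⟨ ℤSum.∑-distrib-+ f g ⟩
  ℤSum.sum f + ℤSum.sum g         ≡⟨ cong₂ _+_ (Σ≡sum m f) (Σ≡sum m g) ⟨
  Σ m f + Σ m g                   ∎

Σ-permute : ∀ m (f : Fin m → ℤ) (π : Permutation′ m) → Σ m (f ∘ (π ⟨$⟩ʳ_)) ≡ Σ m f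
Σ-permute m f π = begin
  Σ m (f ∘ (π ⟨$⟩ʳ_))         ≡⟨ Σ≡sum m _ ⟩
  ℤSum.sum (f ∘ (π ⟨$⟩ʳ_))    ≡⟨ ℤSum.sum-permute f π ⟨
  ℤSum.sum f                  ≡⟨ Σ≡sum m f ⟨
  Σ m f                       ∎

Σ-involution : ∀ m (f : Fin m → ℤ) (φ : Fin m → Fin m) → (∀ i → φ (φ i) ≡ i) → Σ m (f ∘ φ) ≡ Σ m f
Σ-involution m f φ φφ = Σ-permute m f (permutation φ φ φφ φφ)

Σ-++ : ∀ m k (f : Fin (m ℕ.+ k) → ℤ) → Σ (m ℕ.+ k) f ≡ Σ m (f ∘ (_↑ˡ k)) + Σ k (f ∘ (m ↑ʳ_))
Σ-++ zero    k f = sym (+-identityˡ _)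
Σ-++ (suc m) k f = trans (cong (_+_ (f 0F)) (Σ-++ m k (f ∘ Fin.suc))) (sym (+-assoc (f 0F) _ _))

Σ-indicator : ∀ m (U : Subset m) → Σ m (λ i → boolℤ (does (i ∈? U))) ≡ + ∣ U ∣
Σ-indicator zero    []          = refl
Σ-indicator (suc m) (true ∷ U)  = cong (_+_ (+ 1)) (Σ-indicator m U)
Σ-indicator (suc m) (false ∷ U) = trans (+-identityˡ _) (Σ-indicator m U)

module CyclicGroup (n : ℕ) .{{_ : NonZero n}} where
  open Cyclic n

  toℕ-mod : ∀ m → toℕ (m mod n) ≡ m % n
  toℕ-mod m = toℕ-fromℕ< _

  mod-toℕ : ∀ i → toℕ i mod n ≡ i
  mod-toℕ i = toℕ-injective (trans (toℕ-mod (toℕ i)) (m<n⇒m%n≡m (toℕ<n i)))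

  mod-+ : ∀ m k → (m ℕ.+ k) mod n ≡ (m mod n) ⊕ (k mod n)
  mod-+ m k = toℕ-injective (begin
    toℕ ((m ℕ.+ k) mod n)                              ≡⟨ toℕ-mod (m ℕ.+ k) ⟩
    (m ℕ.+ k) % n                                      ≡⟨ %-distribˡ-+ m k n ⟩
    (m % n ℕ.+ k % n) % n                              ≡⟨ cong₂ (λ a b → (a ℕ.+ b) % n) (toℕ-mod m) (toℕ-mod k) ⟨
    (toℕ (m mod n) ℕ.+ toℕ (k mod n)) % n              ≡⟨ toℕ-mod _ ⟨
    toℕ ((m mod n) ⊕ (k mod n))                        ∎)

  ⊕-assoc : ∀ i j k → (i ⊕ j) ⊕ k ≡ i ⊕ (j ⊕ k)
  ⊕-assoc i j k = begin
    (i ⊕ j) ⊕ k                                   ≡⟨ cong ((i ⊕ j) ⊕_) (mod-toℕ k) ⟨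
    (i ⊕ j) ⊕ (toℕ k mod n)                       ≡⟨ mod-+ (toℕ i ℕ.+ toℕ j) (toℕ k) ⟨
    (toℕ i ℕ.+ toℕ j ℕ.+ toℕ k) mod n             ≡⟨ cong (_mod n) (ℕₚ.+-assoc (toℕ i) (toℕ j) (toℕ k)) ⟩
    (toℕ i ℕ.+ (toℕ j ℕ.+ toℕ k)) mod n           ≡⟨ mod-+ (toℕ i) (toℕ j ℕ.+ toℕ k) ⟩
    (toℕ i mod n) ⊕ (j ⊕ k)                       ≡⟨ cong (_⊕ (j ⊕ k)) (mod-toℕ i) ⟩
    i ⊕ (j ⊕ k)                                   ∎

  ⊕-comm : ∀ i j → i ⊕ j ≡ j ⊕ i
  ⊕-comm i j = cong (_mod n) (ℕₚ.+-comm (toℕ i) (toℕ j))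

  ⊕-identityˡ : ∀ i → e ⊕ i ≡ i
  ⊕-identityˡ i = begin
    e ⊕ i                    ≡⟨ cong (e ⊕_) (mod-toℕ i) ⟨
    e ⊕ (toℕ i mod n)        ≡⟨ mod-+ 0 (toℕ i) ⟨
    toℕ i mod n              ≡⟨ mod-toℕ i ⟩
    i                        ∎

  ⊕-identityʳ : ∀ i → i ⊕ e ≡ i
  ⊕-identityʳ i = trans (⊕-comm i e) (⊕-identityˡ i)

  ⊖-inverseʳ : ∀ i → i ⊕ (⊖ i) ≡ e
  ⊖-inverseʳ i = begin
    i ⊕ (⊖ i)                                 ≡⟨ cong (_⊕ (⊖ i)) (mod-toℕ i) ⟨
    (toℕ i mod n) ⊕ ((n ℕ.∸ toℕ i) mod n)     ≡⟨ mod-+ (toℕ i) (n ℕ.∸ toℕ i) ⟨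
    (toℕ i ℕ.+ (n ℕ.∸ toℕ i)) mod n           ≡⟨ cong (_mod n) (m+[n∸m]≡n (<⇒≤ (toℕ<n i))) ⟩
    n mod n                                   ≡⟨ toℕ-injective (trans (toℕ-mod n) (trans ([m+n]%n≡m%n 0 n) (sym (toℕ-mod 0)))) ⟩
    e                                         ∎

  ⊕-isAbelianGroup : IsAbelianGroup _≡_ _⊕_ e ⊖_
  ⊕-isAbelianGroup = record
    { isGroup = record
      { isMonoid = record
        { isSemigroup = record { isMagma = isMagma _⊕_ ; assoc = ⊕-assoc }
        ; identity    = ⊕-identityˡ , ⊕-identityʳ
        }
      ; inverse  = (λ i → trans (⊕-comm (⊖ i) i) (⊖-inverseʳ i)) , ⊖-inverseʳ
      ; ⁻¹-cong  = cong ⊖_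
      }
    ; comm    = ⊕-comm
    }

  ⊕-abelianGroup : AbelianGroup 0ℓ 0ℓ
  ⊕-abelianGroup = record { isAbelianGroup = ⊕-isAbelianGroup }

  open AbelianGroupProperties ⊕-abelianGroup public
    using (ε⁻¹≈ε; ⁻¹-involutive; ⁻¹-∙-comm; ⁻¹-anti-homo‿-; xyx⁻¹≈y)

  x∙[x∙y⁻¹]⁻¹≡y : ∀ k i → k ⊕ (⊖ (k ⊕ (⊖ i))) ≡ i
  x∙[x∙y⁻¹]⁻¹≡y k i = begin
    k ⊕ (⊖ (k ⊕ (⊖ i)))     ≡⟨ cong (k ⊕_) (⁻¹-anti-homo‿- k i) ⟩
    k ⊕ (i ⊕ (⊖ k))         ≡⟨ ⊕-assoc k i (⊖ k) ⟨
    (k ⊕ i) ⊕ (⊖ k)         ≡⟨ xyx⁻¹≈y k i ⟩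
    i                       ∎

module GroupRing (n : ℕ) .{{_ : NonZero n}} where
  open Cyclic n
  open CyclicGroup n

  *ᴳ-comm : ∀ f g → (f *ᴳ g) ≈ᴳ (g *ᴳ f)
  *ᴳ-comm f g k = begin
    Σ n (λ i → f i * g (k ⊕ (⊖ i)))                                   ≡⟨ Σ-cong n (λ i → *-comm (f i) _) ⟩
    Σ n (λ i → g (k ⊕ (⊖ i)) * f i)                                   ≡⟨ Σ-cong n (λ i → cong (λ j → g (k ⊕ (⊖ i)) * f j) (x∙[x∙y⁻¹]⁻¹≡y k i)) ⟨
    Σ n ((λ j → g j * f (k ⊕ (⊖ j))) ∘ (λ i → k ⊕ (⊖ i)))             ≡⟨ Σ-involution n _ (λ i → k ⊕ (⊖ i)) (x∙[x∙y⁻¹]⁻¹≡y k) ⟩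
    Σ n (λ j → g j * f (k ⊕ (⊖ j)))                                   ∎

  *ᴳ-distribʳ-+ᴳ : ∀ f g h → ((f +ᴳ g) *ᴳ h) ≈ᴳ ((f *ᴳ h) +ᴳ (g *ᴳ h))
  *ᴳ-distribʳ-+ᴳ f g h k = trans (Σ-cong n (λ i → *-distribʳ-+ (h (k ⊕ (⊖ i))) (f i) (g i))) (Σ-distrib-+ n _ _)

  *ᴳ-reflectˡ : ∀ f g k → Σ n (λ i → f i * g (k ⊕ i)) ≡ ((f ∘ ⊖_) *ᴳ g) k
  *ᴳ-reflectˡ f g k = begin
    Σ n (λ i → f i * g (k ⊕ i))                          ≡⟨ Σ-cong n (λ i → cong (λ j → f j * g (k ⊕ j)) (⁻¹-involutive i)) ⟨
    Σ n ((λ i → f (⊖ i) * g (k ⊕ (⊖ i))) ∘ ⊖_)           ≡⟨ Σ-involution n _ ⊖_ ⁻¹-involutive ⟩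
    ((f ∘ ⊖_) *ᴳ g) k                                    ∎

module DihedralGroup (n : ℕ) .{{_ : NonZero n}} where
  open Cyclic n
  open CyclicGroup n

  eD : D
  eD = e , false

  reflectIf : Bool → C → C
  reflectIf s j = if s then ⊖ j else j

  reflectIf-⊕ : ∀ s i j → reflectIf s (i ⊕ j) ≡ reflectIf s i ⊕ reflectIf s j
  reflectIf-⊕ false i j = refl
  reflectIf-⊕ true  i j = sym (⁻¹-∙-comm i j)

  reflectIf-xor : ∀ s r k → reflectIf s (reflectIf r k) ≡ reflectIf (s xor r) k
  reflectIf-xor false r     k = refl
  reflectIf-xor true  false k = refl
  reflectIf-xor true  true  k = ⁻¹-involutive k

  ·-assoc : ∀ a b c → (a · b) · c ≡ a · (b · c)
  ·-assoc (i , s) (j , r) (k , q) = cong₂ _,_ (begin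
    (i ⊕ reflectIf s j) ⊕ reflectIf (s xor r) k          ≡⟨ ⊕-assoc i _ _ ⟩
    i ⊕ (reflectIf s j ⊕ reflectIf (s xor r) k)          ≡⟨ cong (λ z → i ⊕ (reflectIf s j ⊕ z)) (reflectIf-xor s r k) ⟨
    i ⊕ (reflectIf s j ⊕ reflectIf s (reflectIf r k))    ≡⟨ cong (i ⊕_) (reflectIf-⊕ s j _) ⟨
    i ⊕ reflectIf s (j ⊕ reflectIf r k)                  ∎) (xor-assoc s r q)

  ·-identityˡ : ∀ a → eD · a ≡ a
  ·-identityˡ (j , r) = cong (_, r) (⊕-identityˡ j)

  ·-identityʳ : ∀ a → a · eD ≡ a
  ·-identityʳ (i , s) = cong₂ _,_ (trans (cong (i ⊕_) (reflectIf-e s)) (⊕-identityʳ i)) (xor-identityʳ s)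
    where
    reflectIf-e : ∀ s → reflectIf s e ≡ e
    reflectIf-e false = refl
    reflectIf-e true  = ε⁻¹≈ε

  ·-inverseˡ : ∀ a → inv a · a ≡ eD
  ·-inverseˡ (i , false) = cong (_, false) (trans (⊕-comm (⊖ i) i) (⊖-inverseʳ i))
  ·-inverseˡ (i , true)  = cong (_, false) (⊖-inverseʳ i)

  ·-inverseʳ : ∀ a → a · inv a ≡ eD
  ·-inverseʳ (i , false) = cong (_, false) (⊖-inverseʳ i)
  ·-inverseʳ (i , true)  = cong (_, false) (⊖-inverseʳ i)

  ·-isGroup : IsGroup _≡_ _·_ eD inv
  ·-isGroup = record
    { isMonoid = record
      { isSemigroup = record { isMagma = isMagma _·_ ; assoc = ·-assoc }
      ; identity    = ·-identityˡ , ·-identityʳ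
      }
    ; inverse  = ·-inverseˡ , ·-inverseʳ
    ; ⁻¹-cong  = cong inv
    }

  ·-group : Group 0ℓ 0ℓ
  ·-group = record { isGroup = ·-isGroup }

  module D = GroupProperties ·-group

module DihedralSum (n : ℕ) .{{_ : NonZero n}} where
  open Cyclic n
  open DihedralGroup n

  ΣD : (D → ℤ) → ℤ
  ΣD g = Σ n (λ i → g (i , false)) + Σ n (λ i → g (i , true))

  ΣD-cong : ∀ {f g : D → ℤ} → f ≗ g → ΣD f ≡ ΣD g
  ΣD-cong f≗g = cong₂ _+_ (Σ-cong n (f≗g ∘ (_, false))) (Σ-cong n (f≗g ∘ (_, true)))

  enc : D → Fin (2 ℕ.* n)
  enc (i , false) = combine {2} {n} 0F i
  enc (i , true)  = combine {2} {n} 1F i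

  dec-enc : ∀ d → dec (enc d) ≡ d
  dec-enc (i , false) rewrite remQuot-combine {2} {n} 0F i = refl
  dec-enc (i , true)  rewrite remQuot-combine {2} {n} 1F i = refl

  enc-dec : ∀ v → enc (dec v) ≡ v
  enc-dec v = trans (cong enc (dec≡fromRemQuot v)) (trans (enc-fromRemQuot (remQuot {2} n v)) (combine-remQuot {2} n v))
    where
    fromRemQuot : Fin 2 × C → D
    fromRemQuot (0F , i) = i , false
    fromRemQuot (1F , i) = i , true
    dec≡fromRemQuot : ∀ v → dec v ≡ fromRemQuot (remQuot {2} n v)
    dec≡fromRemQuot v with remQuot {2} n v
    ... | 0F , i = refl
    ... | 1F , i = refl
    enc-fromRemQuot : ∀ p → enc (fromRemQuot p) ≡ uncurry combine p
    enc-fromRemQuot (0F , i) = refl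
    enc-fromRemQuot (1F , i) = refl

  dec-injective : ∀ {v w} → dec v ≡ dec w → v ≡ w
  dec-injective {v} {w} eq = trans (sym (enc-dec v)) (trans (cong enc eq) (enc-dec w))

  -- enc (i , s) is definitionally the i-th entry of the s-th block of length n in Fin (n + (n + 0)).
  Σ-dec : ∀ g → Σ (2 ℕ.* n) (g ∘ dec) ≡ ΣD g
  Σ-dec g = begin
    Σ (2 ℕ.* n) (g ∘ dec)                                                        ≡⟨ Σ-++ n (n ℕ.+ 0) _ ⟩
    Σ n (g ∘ dec ∘ enc ∘ (_, false)) + Σ (n ℕ.+ 0) (g ∘ dec ∘ (n ↑ʳ_))           ≡⟨ cong (_+_ (Σ n (g ∘ dec ∘ enc ∘ (_, false)))) (Σ-++ n 0 _) ⟩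
    Σ n (g ∘ dec ∘ enc ∘ (_, false)) + (Σ n (g ∘ dec ∘ enc ∘ (_, true)) + + 0)  ≡⟨ cong (_+_ (Σ n (g ∘ dec ∘ enc ∘ (_, false)))) (+-identityʳ _) ⟩
    Σ n (g ∘ dec ∘ enc ∘ (_, false)) + Σ n (g ∘ dec ∘ enc ∘ (_, true))          ≡⟨ cong₂ _+_ (Σ-cong n (cong g ∘ dec-enc ∘ (_, false))) (Σ-cong n (cong g ∘ dec-enc ∘ (_, true))) ⟩
    ΣD g                                                                         ∎

  ΣD-bijection : ∀ g (φ ψ : D → D) → (∀ d → φ (ψ d) ≡ d) → (∀ d → ψ (φ d) ≡ d) → ΣD (g ∘ φ) ≡ ΣD g
  ΣD-bijection g φ ψ φψ ψφ = begin
    ΣD (g ∘ φ)                                  ≡⟨ Σ-dec (g ∘ φ) ⟨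
    Σ (2 ℕ.* n) (g ∘ φ ∘ dec)                   ≡⟨ Σ-cong (2 ℕ.* n) (cong g ∘ dec-enc ∘ φ ∘ dec) ⟨
    Σ (2 ℕ.* n) (g ∘ dec ∘ conj φ)              ≡⟨ Σ-permute (2 ℕ.* n) (g ∘ dec) (permutation (conj φ) (conj ψ) (inverse φ ψ φψ) (inverse ψ φ ψφ)) ⟩
    Σ (2 ℕ.* n) (g ∘ dec)                       ≡⟨ Σ-dec g ⟩
    ΣD g                                        ∎
    where
    conj : (D → D) → Fin (2 ℕ.* n) → Fin (2 ℕ.* n)
    conj f = enc ∘ f ∘ dec
    inverse : ∀ f h → (∀ d → f (h d) ≡ d) → ∀ v → conj f (conj h v) ≡ v
    inverse f h fh v = trans (cong (enc ∘ f) (dec-enc (h (dec v)))) (trans (cong enc (fh (dec v))) (enc-dec v))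

  ΣD-∘-·ʳ : ∀ g u → ΣD (λ m → g (m · u)) ≡ ΣD g
  ΣD-∘-·ʳ g u = ΣD-bijection g (_· u) (_· inv u) (λ m → D.//-rightDividesˡ u m) (λ m → D.//-rightDividesʳ u m)

  ΣD-∘-·inv : ∀ g w → ΣD (λ m → g (w · inv m)) ≡ ΣD g
  ΣD-∘-·inv g w = ΣD-bijection g (λ m → w · inv m) (λ m → inv m · w) cancel₁ cancel₂
    where
    cancel₁ : ∀ m → w · inv (inv m · w) ≡ m
    cancel₁ m = begin
      w · inv (inv m · w)        ≡⟨ cong (w ·_) (D.⁻¹-anti-homo-∙ (inv m) w) ⟩
      w · (inv w · inv (inv m))  ≡⟨ cong (λ x → w · (inv w · x)) (D.⁻¹-involutive m) ⟩
      w · (inv w · m)            ≡⟨ D.\\-leftDividesˡ w m ⟩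
      m                          ∎
    cancel₂ : ∀ m → inv (w · inv m) · w ≡ m
    cancel₂ m = begin
      inv (w · inv m) · w          ≡⟨ cong (_· w) (D.⁻¹-anti-homo-∙ w (inv m)) ⟩
      (inv (inv m) · inv w) · w    ≡⟨ D.//-rightDividesˡ w (inv (inv m)) ⟩
      inv (inv m)                  ≡⟨ D.⁻¹-involutive m ⟩
      m                            ∎

dsrg-regroup : ∀ t l m d a → t * d + l * a + m * (+ 1 - d - a) ≡ (t - m) * d + (l - m) * a + m * + 1
dsrg-regroup = solve-∀

dsrg-regroup-0 : ∀ t l m a → t * + 0 + l * a + m * (+ 1 - + 0 - a) ≡ (l - m) * a + m * + 1
dsrg-regroup-0 = solve-∀

module CayleyGraph (n : ℕ) .{{_ : NonZero n}} (X Y : Subset n) where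
  open Cyclic n
  open CyclicGroup n
  open GroupRing n
  open DihedralGroup n
  open DihedralSum n

  A : Fin (2 ℕ.* n) → Fin (2 ℕ.* n) → ℤ
  A = cayleyAdj X Y

  χ : D → ℤ
  χ d = boolℤ (inS X Y d)

  δₑ : D → ℤ
  δₑ (k , false) = δ e k
  δₑ (k , true)  = + 0

  _⋆_ : (D → ℤ) → (D → ℤ) → D → ℤ
  (f ⋆ g) z = ΣD (λ m → f m * g (z · inv m))

  A²≡χ⋆χ : ∀ U W → Σ (2 ℕ.* n) (λ l → A U l * A l W) ≡ (χ ⋆ χ) (dec W · inv (dec U))
  A²≡χ⋆χ U W = begin
    Σ (2 ℕ.* n) (λ l → A U l * A l W)                     ≡⟨ Σ-dec (λ m → χ (m · inv u) * χ (w · inv m)) ⟩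
    ΣD (λ m → χ (m · inv u) * χ (w · inv m))              ≡⟨ ΣD-∘-·ʳ (λ m → χ (m · inv u) * χ (w · inv m)) u ⟨
    ΣD (λ m → χ ((m · u) · inv u) * χ (w · inv (m · u)))  ≡⟨ ΣD-cong (λ m → cong₂ _*_ (cong χ (D.//-rightDividesʳ u m)) (cong χ (quotient m))) ⟩
    (χ ⋆ χ) (w · inv u)                                   ∎
    where
    u = dec U
    w = dec W
    quotient : ∀ m → w · inv (m · u) ≡ (w · inv u) · inv m
    quotient m = trans (cong (w ·_) (D.⁻¹-anti-homo-∙ m u)) (sym (·-assoc w (inv u) (inv m)))

  δₑ-off-identity : ∀ z → ¬ z ≡ eD → δₑ z ≡ + 0
  δₑ-off-identity (k , true)  _    = refl
  δₑ-off-identity (k , false) z≢eD = cong boolℤ (dec-false (e Fin.≟ k) (λ e≡k → z≢eD (cong (_, false) (sym e≡k))))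

  δ≡δₑ : ∀ U W → δ U W ≡ δₑ (dec W · inv (dec U))
  δ≡δₑ U W with U Fin.≟ W
  ... | yes refl = sym (trans (cong δₑ (·-inverseʳ (dec U))) (cong boolℤ (dec-true (e Fin.≟ e) refl)))
  ... | no  U≢W  = sym (δₑ-off-identity _ (λ z≡eD → U≢W (sym (dec-injective (D.x∙y⁻¹≈ε⇒x≈y (dec W) (dec U) z≡eD)))))

  every-element-is-a-quotient : ∀ z → dec (enc z) · inv (dec (enc eD)) ≡ z
  every-element-is-a-quotient z = begin
    dec (enc z) · inv (dec (enc eD))   ≡⟨ cong₂ (λ a b → a · inv b) (dec-enc z) (dec-enc eD) ⟩
    z · inv eD                         ≡⟨ cong (z ·_) D.ε⁻¹≈ε ⟩
    z · eD                             ≡⟨ ·-identityʳ z ⟩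
    z                                  ∎

  -- Unfolding ⋆, at x^k the rotations x^i contribute X_i X_{k−i} and the reflections x^i a contribute
  -- Y_i Y_{k+i}; at x^k a they contribute X_i Y_{k+i} and Y_i X_{k−i}.
  χ⋆χ-rotation : ∀ k → (χ ⋆ χ) (k , false) ≡ ((bar X *ᴳ bar X) +ᴳ (bar Y *ᴳ barInv Y)) k
  χ⋆χ-rotation k = cong (_+_ ((bar X *ᴳ bar X) k)) (begin
    Σ n (λ i → bar Y i * bar Y (k ⊕ i))   ≡⟨ *ᴳ-reflectˡ (bar Y) (bar Y) k ⟩
    (barInv Y *ᴳ bar Y) k                  ≡⟨ *ᴳ-comm (barInv Y) (bar Y) k ⟩
    (bar Y *ᴳ barInv Y) k                  ∎)

  χ⋆χ-reflection : ∀ k → (χ ⋆ χ) (k , true) ≡ ((bar X +ᴳ barInv X) *ᴳ bar Y) k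
  χ⋆χ-reflection k = begin
    Σ n (λ i → bar X i * bar Y (k ⊕ (⊖ (⊖ i)))) + Σ n (λ i → bar Y i * bar X (k ⊕ (⊖ i)))
      ≡⟨ cong₂ _+_ (Σ-cong n (λ i → cong (λ j → bar X i * bar Y (k ⊕ j)) (⁻¹-involutive i))) (*ᴳ-comm (bar Y) (bar X) k) ⟩
    Σ n (λ i → bar X i * bar Y (k ⊕ i)) + (bar X *ᴳ bar Y) k
      ≡⟨ cong (_+ (bar X *ᴳ bar Y) k) (*ᴳ-reflectˡ (bar X) (bar Y) k) ⟩
    (barInv X *ᴳ bar Y) k + (bar X *ᴳ bar Y) k
      ≡⟨ ℤₚ.+-comm ((barInv X *ᴳ bar Y) k) _ ⟩
    (bar X *ᴳ bar Y) k + (barInv X *ᴳ bar Y) k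
      ≡⟨ *ᴳ-distribʳ-+ᴳ (bar X) (barInv X) (bar Y) k ⟨
    ((bar X +ᴳ barInv X) *ᴳ bar Y) k
      ∎

  ΣD-χ : ΣD χ ≡ + (∣ X ∣ ℕ.+ ∣ Y ∣)
  ΣD-χ = cong₂ _+_ (Σ-indicator n X) (Σ-indicator n Y)

  A-column-sum : ∀ W → Σ (2 ℕ.* n) (λ l → A l W) ≡ + (∣ X ∣ ℕ.+ ∣ Y ∣)
  A-column-sum W = trans (Σ-dec (λ m → χ (dec W · inv m))) (trans (ΣD-∘-·inv χ (dec W)) ΣD-χ)

  A-row-sum : ∀ U → Σ (2 ℕ.* n) (A U) ≡ + (∣ X ∣ ℕ.+ ∣ Y ∣)
  A-row-sum U = trans (Σ-dec (λ m → χ (m · inv (dec U)))) (trans (ΣD-∘-·ʳ χ (inv (dec U))) ΣD-χ)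

  A-zero-one : ∀ U W → A U W ≡ + 0 ⊎ A U W ≡ + 1
  A-zero-one U W with inS X Y (dec W · inv (dec U))
  ... | false = inj₁ refl
  ... | true  = inj₂ refl

  A-zero-diag : e ∉ X → ∀ U → A U U ≡ + 0
  A-zero-diag e∉X U = trans (cong χ (·-inverseʳ (dec U))) (cong boolℤ (dec-false (e ∈? X) e∉X))

  module _ (μ lam t : ℤ) where

    A²-identity : Set
    A²-identity = ∀ U W → Σ (2 ℕ.* n) (λ l → A U l * A l W) ≡ t * δ U W + lam * A U W + μ * (+ 1 - δ U W - A U W)

    dsrgRhs : D → ℤ
    dsrgRhs z = t * δₑ z + lam * χ z + μ * (+ 1 - δₑ z - χ z)

    A²-identity⇔χ⋆χ≡dsrgRhs : A²-identity ⇔ (∀ z → (χ ⋆ χ) z ≡ dsrgRhs z)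
    A²-identity⇔χ⋆χ≡dsrgRhs = mk⇔ to from
      where
      rhs-δ≡δₑ : ∀ U W → t * δ U W + lam * A U W + μ * (+ 1 - δ U W - A U W) ≡ dsrgRhs (dec W · inv (dec U))
      rhs-δ≡δₑ U W = cong (λ d → t * d + lam * A U W + μ * (+ 1 - d - A U W)) (δ≡δₑ U W)
      from : (∀ z → (χ ⋆ χ) z ≡ dsrgRhs z) → A²-identity
      from h U W = trans (A²≡χ⋆χ U W) (trans (h (dec W · inv (dec U))) (sym (rhs-δ≡δₑ U W)))
      to : A²-identity → ∀ z → (χ ⋆ χ) z ≡ dsrgRhs z
      to h z = subst (λ y → (χ ⋆ χ) y ≡ dsrgRhs y) (every-element-is-a-quotient z)
        (trans (sym (A²≡χ⋆χ (enc eD) (enc z))) (trans (h (enc eD) (enc z)) (rhs-δ≡δₑ (enc eD) (enc z))))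

    groupRingEquations : Set
    groupRingEquations =
        ((bar X +ᴳ barInv X) *ᴳ bar Y) ≈ᴳ (((lam - μ) ·ᴳ bar Y) +ᴳ (μ ·ᴳ barC))
      × ((bar X *ᴳ bar X) +ᴳ (bar Y *ᴳ barInv Y)) ≈ᴳ ((((t - μ) ·ᴳ eᴳ) +ᴳ ((lam - μ) ·ᴳ bar X)) +ᴳ (μ ·ᴳ barC))

    dsrgRhs-rotation : ∀ k → dsrgRhs (k , false) ≡ ((((t - μ) ·ᴳ eᴳ) +ᴳ ((lam - μ) ·ᴳ bar X)) +ᴳ (μ ·ᴳ barC)) k
    dsrgRhs-rotation k = dsrg-regroup t lam μ (δ e k) (bar X k)

    dsrgRhs-reflection : ∀ k → dsrgRhs (k , true) ≡ (((lam - μ) ·ᴳ bar Y) +ᴳ (μ ·ᴳ barC)) k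
    dsrgRhs-reflection k = dsrg-regroup-0 t lam μ (bar Y k)

    χ⋆χ≡dsrgRhs⇔groupRingEquations : (∀ z → (χ ⋆ χ) z ≡ dsrgRhs z) ⇔ groupRingEquations
    χ⋆χ≡dsrgRhs⇔groupRingEquations = mk⇔
      (λ h → (λ k → trans (sym (χ⋆χ-reflection k)) (trans (h (k , true)) (dsrgRhs-reflection k)))
           , (λ k → trans (sym (χ⋆χ-rotation k)) (trans (h (k , false)) (dsrgRhs-rotation k))))
      λ where
        (reflections , rotations) (k , true)  → trans (χ⋆χ-reflection k) (trans (reflections k) (sym (dsrgRhs-reflection k)))
        (reflections , rotations) (k , false) → trans (χ⋆χ-rotation k) (trans (rotations k) (sym (dsrgRhs-rotation k)))

    A²-identity⇔groupRingEquations : A²-identity ⇔ groupRingEquations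
    A²-identity⇔groupRingEquations = ⇔.trans A²-identity⇔χ⋆χ≡dsrgRhs χ⋆χ≡dsrgRhs⇔groupRingEquations

mainTheorem9 : (n : ℕ) .{{nz : NonZero n}} (X Y : Subset n) (μ lam t : ℤ) →
    Cyclic.e n ∉ X →
    IsDSRG (2 ℕ.* n) (+ (∣ X ∣ ℕ.+ ∣ Y ∣)) μ lam t (Cyclic.cayleyAdj n X Y)
      ⇔ (Cyclic._≈ᴳ_ n
            (Cyclic._*ᴳ_ n (Cyclic._+ᴳ_ n (Cyclic.bar n X) (Cyclic.barInv n X)) (Cyclic.bar n Y))
            (Cyclic._+ᴳ_ n (Cyclic._·ᴳ_ n (lam - μ) (Cyclic.bar n Y)) (Cyclic._·ᴳ_ n μ (Cyclic.barC n)))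
         × Cyclic._≈ᴳ_ n
            (Cyclic._+ᴳ_ n (Cyclic._*ᴳ_ n (Cyclic.bar n X) (Cyclic.bar n X))
               (Cyclic._*ᴳ_ n (Cyclic.bar n Y) (Cyclic.barInv n Y)))
            (Cyclic._+ᴳ_ n
               (Cyclic._+ᴳ_ n (Cyclic._·ᴳ_ n (t - μ) (Cyclic.eᴳ n)) (Cyclic._·ᴳ_ n (lam - μ) (Cyclic.bar n X)))
               (Cyclic._·ᴳ_ n μ (Cyclic.barC n))))
mainTheorem9 n X Y μ lam t e∉X = mk⇔
  (λ dsrg → Equivalence.to (A²-identity⇔groupRingEquations μ lam t) (IsDSRG.A²-eq dsrg))
  (λ equations → record
    { zero-one  = A-zero-one
    ; zero-diag = A-zero-diag e∉X
    ; JA≡kJ     = λ _ → A-column-sum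
    ; AJ≡kJ     = λ U _ → A-row-sum U
    ; A²-eq     = Equivalence.from (A²-identity⇔groupRingEquations μ lam t) equations
    })
  where open CayleyGraph n X Y
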